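{- Let $P\subseteq\{1,2,3\}^k$ be a puzzle. The following are equivalent: (a) there exist $e\in\{1,2,3\}$ and distinct rows $r_1,r_2\in P$ such that $\{c\in[k]: (r_1)_c=e\}=\{c\in[k]:(r_2)_c=e\}$; (b) there exists a two-element subset $P'\subseteq P$ that is not a strong uniquely solvable puzzle. (Equivalently, the unique-pieces test on $P$ returns NO if and only if the downward-closure test on $P$ with subpuzzle size $2$ returns NO.)
   Context: $[k]=\{1,\dots,k\}$. A puzzle of width $k$ is a finite set $P\subseteq\{1,2,3\}^k$ (elements are rows). $\mathrm{Sym}(P)$ is the group of permutations of $P$. $P$ is a strong uniquely solvable puzzle if for all $\pi_1,\pi_2,\pi_3\in\mathrm{Sym}(P)$, either (i) $\pi_1=\pi_2=\pi_3$, or (ii) there exist $r\in P$ and $c\in[k]$ such that exactly two of $(\pi_1(r))_c=1$, $(\pi_2(r))_c=2$, $(\pi_3(r))_c=3$ hold. The unique-pieces test on $P$ returns NO iff condition (a) holds and MAYBE otherwise; the downward-closure test on $P$ with size $2$ returns NO iff some subset $P'\subseteq P$ with $|P'|=2$ is not a strong uniquely solvable puzzle, and MAYBE otherwise. -}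

module Defs where

open import Data.Nat using (ℕ)
open import Data.Fin using (Fin; zero; suc)
open import Data.Fin.Permutation using (Permutation′; _⟨$⟩ʳ_)
open import Data.Vec using (Vec; lookup)
open import Data.List using (List; length; _∷_; [])
import Data.List as List
open import Data.List.Relation.Unary.Unique.Propositional using (Unique)
open import Data.List.Membership.Propositional using (_∈_)
open import Data.Product using (_×_; Σ; ∃; ∃-syntax; _,_)
open import Data.Sum using (_⊎_)
open import Relation.Nullary using (¬_)
open import Relation.Binary.PropositionalEquality using (_≡_; _≢_)

one two three : Fin 3
one = zero
two = suc zero
three = suc (suc zero)

Row : ℕ → Set
Row k = Vec (Fin 3) k

record Puzzle (k : ℕ) : Set where
  constructor puzzle
  field
    rows   : List (Row k)
    unique : Unique rows
open Puzzle public

ExactlyTwo : Set → Set → Set → Set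
ExactlyTwo A B C = (A × B × ¬ C) ⊎ (A × ¬ B × C) ⊎ (¬ A × B × C)

-- Elements of P are indexed by Fin |P|; Sym(P) is identified with Permutation′ |P|.
-- π(r) for the row at index i is the row at index π i.
row : ∀ {k} (P : Puzzle k) → Fin (length (rows P)) → Row k
row P i = List.lookup (rows P) i

StrongUSP : ∀ {k} → Puzzle k → Set
StrongUSP {k} P =
  (π₁ π₂ π₃ : Permutation′ (length (rows P))) →
    ((∀ i → π₁ ⟨$⟩ʳ i ≡ π₂ ⟨$⟩ʳ i) × (∀ i → π₂ ⟨$⟩ʳ i ≡ π₃ ⟨$⟩ʳ i))
    ⊎ (∃[ i ] ∃[ c ]
        ExactlyTwo (lookup (row P (π₁ ⟨$⟩ʳ i)) c ≡ one)
                   (lookup (row P (π₂ ⟨$⟩ʳ i)) c ≡ two)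
                   (lookup (row P (π₃ ⟨$⟩ʳ i)) c ≡ three))

pair : ∀ {k} (r₁ r₂ : Row k) → r₁ ≢ r₂ → Puzzle k
pair r₁ r₂ ne = puzzle (r₁ ∷ r₂ ∷ []) ((ne Data.List.Relation.Unary.All.∷ Data.List.Relation.Unary.All.[]) Data.List.Relation.Unary.AllPairs.∷ (Data.List.Relation.Unary.All.[] Data.List.Relation.Unary.AllPairs.∷ Data.List.Relation.Unary.AllPairs.[]))
  where import Data.List.Relation.Unary.All
        import Data.List.Relation.Unary.AllPairs

UniquePiecesNO : ∀ {k} → Puzzle k → Set
UniquePiecesNO {k} P =
  ∃[ e ] ∃[ r₁ ] ∃[ r₂ ] (r₁ ∈ rows P × r₂ ∈ rows P × r₁ ≢ r₂ ×
    (∀ (c : Fin k) → (lookup r₁ c ≡ e → lookup r₂ c ≡ e) × (lookup r₂ c ≡ e → lookup r₁ c ≡ e)))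

DownwardClosure2NO : ∀ {k} → Puzzle k → Set
DownwardClosure2NO {k} P =
  ∃[ r₁ ] ∃[ r₂ ] Σ (r₁ ≢ r₂) λ ne → r₁ ∈ rows P × r₂ ∈ rows P × ¬ StrongUSP (pair r₁ r₂ ne)

-- A permutation of a two-element set is the identity or the swap. So if π₁, π₂, π₃ permute
-- the pair {r₁, r₂} and are not all equal, exactly one of them, π_e, differs from the other
-- two, and on every index it picks the row the other two do not. Exactly two of the three
-- conditions then hold in column c iff π_e picks a row with symbol e in column c and the
-- others pick a row without it. Such an index and column exist iff the e-pieces of r₁ and
-- r₂ differ; hence {r₁, r₂} is a strong USP if all three pairs of pieces differ.
-- Conversely, if the e-pieces agree, swapping the two rows in position e alone never makes
-- exactly two conditions hold.

module Submission where

open import Defs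
open import Data.Nat using (ℕ)
open import Data.Product using (_×_; _,_; proj₁; proj₂; ∃-syntax)
open import Data.Sum using (_⊎_; inj₁; inj₂; [_,_]′)
open import Data.Fin using (Fin; zero; suc; opposite)
open import Data.Fin.Properties using (_≟_; all?; ¬∀⟶∃¬)
open import Data.Fin.Permutation using (Permutation′; _⟨$⟩ʳ_; _⟨$⟩ˡ_; inverseʳ; _≈_; id; reverse; _∘ₚ_)
open import Data.Vec using (lookup)
open import Function using (_∘_)
open import Function.Bundles using (Injection)
open import Function.Properties.Inverse using (↔⇒↣)
open import Relation.Nullary using (¬_; Dec; yes; no; contradiction)
open import Relation.Nullary.Decidable using (_×-dec_; _→-dec_)
open import Relation.Binary.PropositionalEquality

OddOneOut : Fin 3 → Fin 3 → Fin 3 → Set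
OddOneOut zero             x y = ExactlyTwo (x ≡ one) (y ≡ two) (y ≡ three)
OddOneOut (suc zero)       x y = ExactlyTwo (y ≡ one) (x ≡ two) (y ≡ three)
OddOneOut (suc (suc zero)) x y = ExactlyTwo (y ≡ one) (y ≡ two) (x ≡ three)

oddOneOut⁺ : ∀ e {x y} → x ≡ e → y ≢ e → OddOneOut e x y
oddOneOut⁺ zero             {y = zero}             refl y≢e = contradiction refl y≢e
oddOneOut⁺ zero             {y = suc zero}         refl _   = inj₁ (refl , refl , λ ())
oddOneOut⁺ zero             {y = suc (suc zero)}   refl _   = inj₂ (inj₁ (refl , (λ ()) , refl))
oddOneOut⁺ (suc zero)       {y = zero}             refl _   = inj₁ (refl , refl , λ ())
oddOneOut⁺ (suc zero)       {y = suc zero}         refl y≢e = contradiction refl y≢e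
oddOneOut⁺ (suc zero)       {y = suc (suc zero)}   refl _   = inj₂ (inj₂ ((λ ()) , refl , refl))
oddOneOut⁺ (suc (suc zero)) {y = zero}             refl _   = inj₂ (inj₁ (refl , (λ ()) , refl))
oddOneOut⁺ (suc (suc zero)) {y = suc zero}         refl _   = inj₂ (inj₂ ((λ ()) , refl , refl))
oddOneOut⁺ (suc (suc zero)) {y = suc (suc zero)}   refl y≢e = contradiction refl y≢e

oddOneOut⁻ : ∀ e {x y} → OddOneOut e x y → x ≡ e × y ≢ e
oddOneOut⁻ zero             (inj₁ (refl , refl , _))        = refl , λ ()
oddOneOut⁻ zero             (inj₂ (inj₁ (refl , _ , refl))) = refl , λ ()
oddOneOut⁻ zero             (inj₂ (inj₂ (_ , refl , ())))
oddOneOut⁻ (suc zero)       (inj₁ (refl , refl , _))        = refl , λ ()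
oddOneOut⁻ (suc zero)       (inj₂ (inj₁ (refl , _ , ())))
oddOneOut⁻ (suc zero)       (inj₂ (inj₂ (_ , refl , refl))) = refl , λ ()
oddOneOut⁻ (suc (suc zero)) (inj₁ (refl , () , _))
oddOneOut⁻ (suc (suc zero)) (inj₂ (inj₁ (refl , _ , refl))) = refl , λ ()
oddOneOut⁻ (suc (suc zero)) (inj₂ (inj₂ (_ , refl , refl))) = refl , λ ()

opposite-≢ : (i : Fin 2) → opposite i ≢ i
opposite-≢ zero       ()
opposite-≢ (suc zero) ()

≢⇒≡opposite : {i j : Fin 2} → i ≢ j → j ≡ opposite i
≢⇒≡opposite {zero}     {zero}     i≢j = contradiction refl i≢j
≢⇒≡opposite {zero}     {suc zero} _   = refl
≢⇒≡opposite {suc zero} {zero}     _   = refl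
≢⇒≡opposite {suc zero} {suc zero} i≢j = contradiction refl i≢j

reverse≉id : ¬ (reverse ≈ id {2})
reverse≉id p = contradiction (p zero) λ ()

permute-opposite : (π : Permutation′ 2) (i : Fin 2) → π ⟨$⟩ʳ opposite i ≡ opposite (π ⟨$⟩ʳ i)
permute-opposite π i = ≢⇒≡opposite (opposite-≢ i ∘ sym ∘ Injection.injective (↔⇒↣ π))

agreeAt₀⇒≈ : (π σ : Permutation′ 2) → π ⟨$⟩ʳ zero ≡ σ ⟨$⟩ʳ zero → π ≈ σ
agreeAt₀⇒≈ _ _ eq zero = eq
agreeAt₀⇒≈ π σ eq (suc zero) = begin
  π ⟨$⟩ʳ opposite zero    ≡⟨ permute-opposite π zero ⟩
  opposite (π ⟨$⟩ʳ zero)  ≡⟨ cong opposite eq ⟩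
  opposite (σ ⟨$⟩ʳ zero)  ≡⟨ permute-opposite σ zero ⟨
  σ ⟨$⟩ʳ opposite zero    ∎
  where open ≡-Reasoning

disagreeAt₀⇒∘reverse≈ : (π σ : Permutation′ 2) → π ⟨$⟩ʳ zero ≢ σ ⟨$⟩ʳ zero → π ∘ₚ reverse ≈ σ
disagreeAt₀⇒∘reverse≈ π σ π≢σ = agreeAt₀⇒≈ (π ∘ₚ reverse) σ (sym (≢⇒≡opposite π≢σ))

∘reverse≈⇒opposite : (π σ : Permutation′ 2) → π ∘ₚ reverse ≈ σ → ∀ j → σ ⟨$⟩ʳ (π ⟨$⟩ˡ j) ≡ opposite j
∘reverse≈⇒opposite π _ π′≈σ j = trans (sym (π′≈σ (π ⟨$⟩ˡ j))) (cong opposite (inverseʳ π))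

module _ {k : ℕ} (r₁ r₂ : Row k) (r₁≢r₂ : r₁ ≢ r₂) where

  private
    Q : Puzzle k
    Q = pair r₁ r₂ r₁≢r₂

    ρ : Fin 2 → Row k
    ρ = row Q

  SamePieceAt : Fin 3 → Fin k → Set
  SamePieceAt e c = (lookup r₁ c ≡ e → lookup r₂ c ≡ e) × (lookup r₂ c ≡ e → lookup r₁ c ≡ e)

  SamePiece : Fin 3 → Set
  SamePiece e = ∀ c → SamePieceAt e c

  PiecesDiffer : Fin 3 → Set
  PiecesDiffer e = ∃[ c ] ∃[ j ] (lookup (ρ j) c ≡ e × lookup (ρ (opposite j)) c ≢ e)

  samePiece-opposite : ∀ {e} → SamePiece e → ∀ i c → lookup (ρ (opposite i)) c ≡ e → lookup (ρ i) c ≡ e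
  samePiece-opposite same zero       c = proj₂ (same c)
  samePiece-opposite same (suc zero) c = proj₁ (same c)

  samePieceAt? : ∀ e c → Dec (SamePieceAt e c)
  samePieceAt? e c = ((lookup r₁ c ≟ e) →-dec (lookup r₂ c ≟ e)) ×-dec ((lookup r₂ c ≟ e) →-dec (lookup r₁ c ≟ e))

  ¬samePieceAt⇒piecesDiffer : ∀ {e} c → ¬ SamePieceAt e c → PiecesDiffer e
  ¬samePieceAt⇒piecesDiffer {e} c ¬same with lookup r₁ c ≟ e | lookup r₂ c ≟ e
  ... | yes p | yes q = contradiction ((λ _ → q) , (λ _ → p)) ¬same
  ... | yes p | no ¬q = c , zero , p , ¬q
  ... | no ¬p | yes q = c , suc zero , q , ¬p
  ... | no ¬p | no ¬q = contradiction ((λ p → contradiction p ¬p) , (λ q → contradiction q ¬q)) ¬same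

  samePiece⊎piecesDiffer : ∀ e → SamePiece e ⊎ PiecesDiffer e
  samePiece⊎piecesDiffer e with all? (samePieceAt? e)
  ... | yes same = inj₁ same
  ... | no ¬same =
    let (c , ¬sameAt) = ¬∀⟶∃¬ k _ (samePieceAt? e) ¬same in inj₂ (¬samePieceAt⇒piecesDiffer c ¬sameAt)

  Cell : Fin k → Fin 2 → Fin 2 → Fin 2 → Set
  Cell c j₁ j₂ j₃ = ExactlyTwo (lookup (ρ j₁) c ≡ one) (lookup (ρ j₂) c ≡ two) (lookup (ρ j₃) c ≡ three)

  Solved : (π₁ π₂ π₃ : Permutation′ 2) → Set
  Solved π₁ π₂ π₃ = ∃[ i ] ∃[ c ] Cell c (π₁ ⟨$⟩ʳ i) (π₂ ⟨$⟩ʳ i) (π₃ ⟨$⟩ʳ i)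

  solvedAt : ∀ π₁ π₂ π₃ {i j₁ j₂ j₃} c →
             π₁ ⟨$⟩ʳ i ≡ j₁ → π₂ ⟨$⟩ʳ i ≡ j₂ → π₃ ⟨$⟩ʳ i ≡ j₃ → Cell c j₁ j₂ j₃ → Solved π₁ π₂ π₃
  solvedAt _ _ _ c refl refl refl cell = _ , c , cell

  solved₁ : ∀ π₁ π₂ π₃ → PiecesDiffer one → π₁ ∘ₚ reverse ≈ π₂ → π₁ ∘ₚ reverse ≈ π₃ → Solved π₁ π₂ π₃
  solved₁ π₁ π₂ π₃ (c , j , p , q) h₂ h₃ =
    solvedAt π₁ π₂ π₃ c (inverseʳ π₁) (∘reverse≈⇒opposite π₁ π₂ h₂ j) (∘reverse≈⇒opposite π₁ π₃ h₃ j)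
      (oddOneOut⁺ one p q)

  solved₂ : ∀ π₁ π₂ π₃ → PiecesDiffer two → π₂ ∘ₚ reverse ≈ π₁ → π₂ ∘ₚ reverse ≈ π₃ → Solved π₁ π₂ π₃
  solved₂ π₁ π₂ π₃ (c , j , p , q) h₁ h₃ =
    solvedAt π₁ π₂ π₃ c (∘reverse≈⇒opposite π₂ π₁ h₁ j) (inverseʳ π₂) (∘reverse≈⇒opposite π₂ π₃ h₃ j)
      (oddOneOut⁺ two p q)

  solved₃ : ∀ π₁ π₂ π₃ → PiecesDiffer three → π₃ ∘ₚ reverse ≈ π₁ → π₃ ∘ₚ reverse ≈ π₂ → Solved π₁ π₂ π₃
  solved₃ π₁ π₂ π₃ (c , j , p , q) h₁ h₂ =
    solvedAt π₁ π₂ π₃ c (∘reverse≈⇒opposite π₃ π₁ h₁ j) (∘reverse≈⇒opposite π₃ π₂ h₂ j) (inverseʳ π₃)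
      (oddOneOut⁺ three p q)

  piecesDiffer⇒strongUSP : PiecesDiffer one → PiecesDiffer two → PiecesDiffer three → StrongUSP Q
  piecesDiffer⇒strongUSP d₁ d₂ d₃ π₁ π₂ π₃ with π₁ ⟨$⟩ʳ zero ≟ π₂ ⟨$⟩ʳ zero | π₂ ⟨$⟩ʳ zero ≟ π₃ ⟨$⟩ʳ zero
  ... | yes p | yes q = inj₁ (agreeAt₀⇒≈ π₁ π₂ p , agreeAt₀⇒≈ π₂ π₃ q)
  ... | no ¬p | yes q = inj₂ (solved₁ π₁ π₂ π₃ d₁ π₁′≈π₂ (λ i → trans (π₁′≈π₂ i) (agreeAt₀⇒≈ π₂ π₃ q i)))
    where π₁′≈π₂ = disagreeAt₀⇒∘reverse≈ π₁ π₂ ¬p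
  ... | no ¬p | no ¬q =
    inj₂ (solved₂ π₁ π₂ π₃ d₂ (disagreeAt₀⇒∘reverse≈ π₂ π₁ (¬p ∘ sym)) (disagreeAt₀⇒∘reverse≈ π₂ π₃ ¬q))
  ... | yes p | no ¬q = inj₂ (solved₃ π₁ π₂ π₃ d₃ (λ i → trans (π₃′≈π₂ i) (sym (agreeAt₀⇒≈ π₁ π₂ p i))) π₃′≈π₂)
    where π₃′≈π₂ = disagreeAt₀⇒∘reverse≈ π₃ π₂ (¬q ∘ sym)

  ¬oddCell : ∀ e → SamePiece e → ¬ (∃[ i ] ∃[ c ] OddOneOut e (lookup (ρ (opposite i)) c) (lookup (ρ i) c))
  ¬oddCell e same (i , c , cell) = let (p , ¬q) = oddOneOut⁻ e cell in ¬q (samePiece-opposite same i c p)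

  samePiece⇒¬strongUSP : ∀ e → SamePiece e → ¬ StrongUSP Q
  samePiece⇒¬strongUSP zero             same usp =
    [ reverse≉id ∘ proj₁ , ¬oddCell one same ]′ (usp reverse id id)
  samePiece⇒¬strongUSP (suc zero)       same usp =
    [ reverse≉id ∘ proj₂ , ¬oddCell two same ]′ (usp id reverse id)
  samePiece⇒¬strongUSP (suc (suc zero)) same usp =
    [ (λ (_ , id≈reverse) → reverse≉id (sym ∘ id≈reverse)) , ¬oddCell three same ]′ (usp id id reverse)

  ¬strongUSP⇒samePiece : ¬ StrongUSP Q → ∃[ e ] SamePiece e
  ¬strongUSP⇒samePiece ¬usp
    with samePiece⊎piecesDiffer one | samePiece⊎piecesDiffer two | samePiece⊎piecesDiffer three
  ... | inj₁ same | _         | _         = one , same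
  ... | inj₂ _    | inj₁ same | _         = two , same
  ... | inj₂ _    | inj₂ _    | inj₁ same = three , same
  ... | inj₂ d₁   | inj₂ d₂   | inj₂ d₃   = contradiction (piecesDiffer⇒strongUSP d₁ d₂ d₃) ¬usp

lemma7 : {k : ℕ} (P : Puzzle k) →
    (UniquePiecesNO P → DownwardClosure2NO P) × (DownwardClosure2NO P → UniquePiecesNO P)
lemma7 P =
    (λ (e , r₁ , r₂ , r₁∈P , r₂∈P , r₁≢r₂ , same) →
       r₁ , r₂ , r₁≢r₂ , r₁∈P , r₂∈P , samePiece⇒¬strongUSP r₁ r₂ r₁≢r₂ e same)
  , (λ (r₁ , r₂ , r₁≢r₂ , r₁∈P , r₂∈P , ¬usp) →
       let (e , same) = ¬strongUSP⇒samePiece r₁ r₂ r₁≢r₂ ¬usp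
       in  e , r₁ , r₂ , r₁∈P , r₂∈P , r₁≢r₂ , same)
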